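{- For $k\ge1$, the mapping $X\subseteq\mathbb{Z}^k\ \mapsto\ \{(i_2,\ldots,i_k) : (0,i_2,\ldots,i_k)\in X\}\subseteq\mathbb{Z}^{k-1}$ is a bijection between the subsets of $\mathbb{Z}^k$ that are both semilinear and equivariant, and the semilinear (not necessarily equivariant) subsets of $\mathbb{Z}^{k-1}$.
   Context: Semilinear subsets of $\mathbb{Z}^m$ are those definable in Presburger arithmetic. A subset $X\subseteq\mathbb{Z}^k$ is equivariant if it is invariant under all diagonal translations $(x_1,\ldots,x_k)\mapsto(x_1+z,\ldots,x_k+z)$, $z\in\mathbb{Z}$ (the automorphisms of the integer atoms $(\mathbb{Z},+1)$). -}

module Defs where

open import Level using (0ℓ)
open import Data.Nat using (ℕ; suc)
open import Data.Integer using (ℤ; _+_; _*_; +_; 0ℤ)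
open import Data.Vec using (Vec; []; _∷_; map; zipWith; replicate; foldr)
open import Data.List using (List)
open import Data.List.Relation.Unary.Any using (Any)
open import Data.Product using (Σ; ∃; _×_)
open import Relation.Binary.PropositionalEquality using (_≡_)
open import Relation.Unary using (Pred)

Point : ℕ → Set
Point m = Vec ℤ m

Subset : ℕ → Set₁
Subset m = Pred (Point m) 0ℓ

_⊕_ : ∀ {m} → Point m → Point m → Point m
_⊕_ = zipWith _+_

_⊙_ : ∀ {m} → ℕ → Point m → Point m
c ⊙ v = map ((+ c) *_) v

-- A linear set  { b + c₁ p₁ + ... + c_r p_r  |  cᵢ ∈ ℕ }  ⊆ ℤ^m,
-- given by a base vector b and finitely many period vectors pᵢ.
record Linear (m : ℕ) : Set where
  constructor linear
  field
    r       : ℕ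
    base    : Point m
    periods : Vec (Point m) r

combo : ∀ {m r} → Vec ℕ r → Vec (Point m) r → Point m
combo {m} [] [] = replicate m 0ℤ
combo (c ∷ cs) (p ∷ ps) = (c ⊙ p) ⊕ combo cs ps

_∈L_ : ∀ {m} → Point m → Linear m → Set
v ∈L linear r b ps = ∃ λ (cs : Vec ℕ r) → v ≡ b ⊕ combo cs ps

-- Semilinear set: a finite union of linear sets.
-- (Equivalently, by Ginsburg–Spanier, a set definable in Presburger arithmetic.)
Semilinear : ∀ {m} → Subset m → Set
Semilinear {m} X =
  Σ (List (Linear m)) λ Ls → ∀ v → (X v → Any (v ∈L_) Ls) × (Any (v ∈L_) Ls → X v)

shift : ∀ {m} → ℤ → Point m → Point m
shift z = map (λ x → z + x)

Equivariant : ∀ {m} → Subset m → Set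
Equivariant X = ∀ z v → (X v → X (shift z v)) × (X (shift z v) → X v)

_≐_ : ∀ {m} → Subset m → Subset m → Set
X ≐ Y = ∀ v → (X v → Y v) × (Y v → X v)

slice : ∀ {n} → Subset (suc n) → Subset n
slice X v = X (0ℤ ∷ v)

module Submission where

-- An equivariant set X ⊆ ℤ^(1+n) is determined by its slice at first
-- coordinate 0: translating by the negated first coordinate gives
--   X (x ∷ u)  ⇔  slice X (norm (x ∷ u)),   where  norm (x ∷ u) = u - x·𝟙.
-- This proves injectivity outright, and shows that the slice of an
-- equivariant X is its image under norm, while the equivariant set with
-- prescribed slice Y is the preimage  Y ∘ norm.
--
-- Semilinearity is handled by two closure properties, proved on linear
-- sets and lifted to finite unions:
--   * images under additive, ℕ-homogeneous maps ("homomorphisms") of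
--     semilinear sets are semilinear;
--   * the cylinder ℤ × Y over a semilinear Y is semilinear.
-- The preimage Y ∘ norm is the image of the cylinder ℤ × Y under the
-- shear (z ∷ u) ↦ z ∷ (u + z·𝟙), an automorphism inverse to (x ∷ u) ↦
-- (x ∷ norm (x ∷ u)); so both semilinearity claims reduce to the closure
-- properties.

open import Defs
open import Data.Nat using (ℕ; suc)
open import Data.Integer as ℤ using (ℤ; +_; -[1+_]; 0ℤ; 1ℤ; -1ℤ; -_; _-_)
import Data.Integer.Properties as ℤP
open import Data.Integer.Solver using (module +-*-Solver)
open import Data.Vec as V using (Vec; []; _∷_; replicate; zipWith)
open import Data.List as List using (List)
open import Data.List.Relation.Unary.Any as Any using (Any; here; there)
import Data.List.Relation.Unary.Any.Properties as AnyP
open import Data.Product using (Σ; ∃; ∃₂; _×_; _,_; proj₁; proj₂)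
open import Relation.Binary.PropositionalEquality

zeroV : ∀ {m} → Point m
zeroV {m} = replicate m 0ℤ

shift-identity : ∀ {m} (u : Point m) → shift 0ℤ u ≡ u
shift-identity []      = refl
shift-identity (a ∷ u) = cong₂ _∷_ (ℤP.+-identityˡ a) (shift-identity u)

shift-shift : ∀ {m} x y (u : Point m) → shift x (shift y u) ≡ shift (x ℤ.+ y) u
shift-shift x y []      = refl
shift-shift x y (a ∷ u) = cong₂ _∷_ (sym (ℤP.+-assoc x y a)) (shift-shift x y u)

shift-⊕ : ∀ {m} x y (u w : Point m) → shift (x ℤ.+ y) (u ⊕ w) ≡ shift x u ⊕ shift y w
shift-⊕ x y []      []      = refl
shift-⊕ x y (a ∷ u) (b ∷ w) = cong₂ _∷_ (interchange x y a b) (shift-⊕ x y u w)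
  where
  open +-*-Solver
  interchange : ∀ x y a b → (x ℤ.+ y) ℤ.+ (a ℤ.+ b) ≡ (x ℤ.+ a) ℤ.+ (y ℤ.+ b)
  interchange = solve 4 (λ x y a b → (x :+ y) :+ (a :+ b) := (x :+ a) :+ (y :+ b)) refl

shift-⊙ : ∀ {m} c x (u : Point m) → shift (+ c ℤ.* x) (c ⊙ u) ≡ c ⊙ shift x u
shift-⊙ c x []      = refl
shift-⊙ c x (a ∷ u) = cong₂ _∷_ (sym (ℤP.*-distribˡ-+ (+ c) x a)) (shift-⊙ c x u)

⊙-zeroV : ∀ {m} c → c ⊙ zeroV {m} ≡ zeroV
⊙-zeroV {0}     c = refl
⊙-zeroV {suc m} c = cong₂ _∷_ (ℤP.*-zeroʳ (+ c)) (⊙-zeroV c)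

⊕-identityˡ : ∀ {m} (u : Point m) → zeroV ⊕ u ≡ u
⊕-identityˡ []      = refl
⊕-identityˡ (a ∷ u) = cong₂ _∷_ (ℤP.+-identityˡ a) (⊕-identityˡ u)

-- A homomorphism ℤ^m → ℤ^k: additive, commuting with ℕ-scaling, and
-- fixing the origin.  Exactly what is needed to map linear sets to
-- linear sets.
record IsHom {m k} (f : Point m → Point k) : Set where
  field
    hom-⊕    : ∀ u w → f (u ⊕ w) ≡ f u ⊕ f w
    hom-⊙    : ∀ c u → f (c ⊙ u) ≡ c ⊙ f u
    hom-zero : f zeroV ≡ zeroV

  hom-combo : ∀ {r} (cs : Vec ℕ r) ps → f (combo cs ps) ≡ combo cs (V.map f ps)
  hom-combo []       []       = hom-zero
  hom-combo (c ∷ cs) (p ∷ ps) = begin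
    f ((c ⊙ p) ⊕ combo cs ps)       ≡⟨ hom-⊕ (c ⊙ p) (combo cs ps) ⟩
    f (c ⊙ p) ⊕ f (combo cs ps)     ≡⟨ cong₂ _⊕_ (hom-⊙ c p) (hom-combo cs ps) ⟩
    (c ⊙ f p) ⊕ combo cs (V.map f ps) ∎
    where open ≡-Reasoning

semilinear-resp : ∀ {m} {X Y : Subset m} → X ≐ Y → Semilinear X → Semilinear Y
semilinear-resp X≐Y (Ls , X⇔Ls) = Ls , λ v →
  (λ Yv → proj₁ (X⇔Ls v) (proj₂ (X≐Y v) Yv)) , (λ v∈ → proj₁ (X≐Y v) (proj₂ (X⇔Ls v) v∈))

Image : ∀ {m k} → (Point m → Point k) → Subset m → Subset k
Image f X w = ∃ λ v → X v × f v ≡ w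

mapL : ∀ {m k} → (Point m → Point k) → Linear m → Linear k
mapL f (linear r b ps) = linear r (f b) (V.map f ps)

module _ {m k} {f : Point m → Point k} (hom : IsHom f) where
  open IsHom hom

  hom-point : ∀ {r} b (cs : Vec ℕ r) ps → f (b ⊕ combo cs ps) ≡ f b ⊕ combo cs (V.map f ps)
  hom-point b cs ps = trans (hom-⊕ b (combo cs ps)) (cong (f b ⊕_) (hom-combo cs ps))

  ∈-mapL : ∀ {v L} → v ∈L L → f v ∈L mapL f L
  ∈-mapL {L = linear r b ps} (cs , refl) = cs , hom-point b cs ps

  ∈-mapL⁻ : ∀ {w} L → w ∈L mapL f L → ∃ λ v → v ∈L L × f v ≡ w
  ∈-mapL⁻ (linear r b ps) (cs , w≡) = b ⊕ combo cs ps , (cs , refl) , trans (hom-point b cs ps) (sym w≡)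

  any-mapL⁻ : ∀ {w} (Ls : List (Linear m)) →
    Any (w ∈L_) (List.map (mapL f) Ls) → ∃ λ v → Any (v ∈L_) Ls × f v ≡ w
  any-mapL⁻ (L List.∷ Ls) (here w∈) with ∈-mapL⁻ L w∈
  ... | v , v∈ , fv≡w = v , here v∈ , fv≡w
  any-mapL⁻ (L List.∷ Ls) (there w∈) with any-mapL⁻ Ls w∈
  ... | v , v∈ , fv≡w = v , there v∈ , fv≡w

  semilinear-image : ∀ {X : Subset m} → Semilinear X → Semilinear (Image f X)
  semilinear-image {X} (Ls , X⇔Ls) = List.map (mapL f) Ls , λ w →
    (λ { (v , Xv , refl) → AnyP.map⁺ (Any.map ∈-mapL (proj₁ (X⇔Ls v) Xv)) }) ,
    (λ w∈ → let (v , v∈ , fv≡w) = any-mapL⁻ Ls w∈ in v , proj₂ (X⇔Ls v) v∈ , fv≡w)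

Cyl : ∀ {m} → Subset m → Subset (suc m)
Cyl Y v = Y (V.tail v)

dot : ∀ {r} → Vec ℕ r → Vec ℤ r → ℤ
dot []       []       = 0ℤ
dot (c ∷ cs) (h ∷ hs) = + c ℤ.* h ℤ.+ dot cs hs

combo-∷ : ∀ {m r} (cs : Vec ℕ r) hs (ps : Vec (Point m) r) →
  combo cs (zipWith _∷_ hs ps) ≡ dot cs hs ∷ combo cs ps
combo-∷ []       []       []       = refl
combo-∷ (c ∷ cs) (h ∷ hs) (p ∷ ps) = cong ((c ⊙ (h ∷ p)) ⊕_) (combo-∷ cs hs ps)

dot-zeros : ∀ {r} (cs : Vec ℕ r) → dot cs (replicate r 0ℤ) ≡ 0ℤ
dot-zeros []       = refl
dot-zeros (c ∷ cs) = cong₂ ℤ._+_ (ℤP.*-zeroʳ (+ c)) (dot-zeros cs)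

integer-difference : ∀ z → ∃₂ λ a b → + a - + b ≡ z
integer-difference (+ a)    = a , 0 , ℤP.+-identityʳ (+ a)
integer-difference -[1+ b ] = 0 , suc b , refl

-- ℤ × L for a linear L: the periods ±(1, 0, …, 0) generate the free
-- first coordinate, the others are those of L with first coordinate 0.
cylL : ∀ {m} → Linear m → Linear (suc m)
cylL (linear r b ps) =
  linear (suc (suc r)) (0ℤ ∷ b) (zipWith _∷_ (1ℤ ∷ -1ℤ ∷ replicate r 0ℤ) (zeroV ∷ zeroV ∷ ps))

cylL-point : ∀ {m r} (b : Point m) c₁ c₂ (cs : Vec ℕ r) ps →
  (0ℤ ∷ b) ⊕ combo (c₁ ∷ c₂ ∷ cs) (zipWith _∷_ (1ℤ ∷ -1ℤ ∷ replicate r 0ℤ) (zeroV ∷ zeroV ∷ ps))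
    ≡ (+ c₁ - + c₂) ∷ (b ⊕ combo cs ps)
cylL-point b c₁ c₂ cs ps =
  trans (cong ((0ℤ ∷ b) ⊕_) (combo-∷ (c₁ ∷ c₂ ∷ cs) (1ℤ ∷ -1ℤ ∷ replicate _ 0ℤ) (zeroV ∷ zeroV ∷ ps)))
        (cong₂ _∷_ first-coordinate (cong (b ⊕_) zero-periods))
  where
  open +-*-Solver
  first-coordinate : 0ℤ ℤ.+ dot (c₁ ∷ c₂ ∷ cs) (1ℤ ∷ -1ℤ ∷ replicate _ 0ℤ) ≡ + c₁ - + c₂
  first-coordinate rewrite dot-zeros cs =
    solve 2 (λ a b → con 0ℤ :+ (a :* con 1ℤ :+ (b :* con -1ℤ :+ con 0ℤ)) := a :+ :- b)
      refl (+ c₁) (+ c₂)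
  zero-periods : (c₁ ⊙ zeroV) ⊕ ((c₂ ⊙ zeroV) ⊕ combo cs ps) ≡ combo cs ps
  zero-periods = begin
    (c₁ ⊙ zeroV) ⊕ ((c₂ ⊙ zeroV) ⊕ combo cs ps) ≡⟨ cong₂ (λ x y → x ⊕ (y ⊕ combo cs ps)) (⊙-zeroV c₁) (⊙-zeroV c₂) ⟩
    zeroV ⊕ (zeroV ⊕ combo cs ps)                ≡⟨ trans (⊕-identityˡ _) (⊕-identityˡ (combo cs ps)) ⟩
    combo cs ps                                  ∎
    where open ≡-Reasoning

∈-cylL : ∀ {m} {v : Point (suc m)} {L} → v ∈L cylL L → V.tail v ∈L L
∈-cylL {L = linear r b ps} (c₁ ∷ c₂ ∷ cs , v≡) = cs , cong V.tail (trans v≡ (cylL-point b c₁ c₂ cs ps))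

∈-cylL⁻ : ∀ {m} {z} {u : Point m} {L} → u ∈L L → (z ∷ u) ∈L cylL L
∈-cylL⁻ {z = z} {L = linear r b ps} (cs , refl) with integer-difference z
... | c₁ , c₂ , refl = (c₁ ∷ c₂ ∷ cs) , sym (cylL-point b c₁ c₂ cs ps)

semilinear-cyl : ∀ {m} {Y : Subset m} → Semilinear Y → Semilinear (Cyl Y)
semilinear-cyl (Ls , Y⇔Ls) = List.map cylL Ls , λ where
  (z ∷ u) → (λ Yu → AnyP.map⁺ (Any.map ∈-cylL⁻ (proj₁ (Y⇔Ls u) Yu))) ,
            (λ v∈ → proj₂ (Y⇔Ls u) (Any.map ∈-cylL (AnyP.map⁻ v∈)))

norm : ∀ {n} → Point (suc n) → Point n
norm (x ∷ u) = shift (- x) u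

shear : ∀ {n} → Point (suc n) → Point (suc n)
shear (z ∷ u) = z ∷ shift z u

norm-hom : ∀ {n} → IsHom (norm {n})
norm-hom = record
  { hom-⊕    = λ { (x ∷ u) (y ∷ w) →
      trans (cong (λ t → shift t (u ⊕ w)) (ℤP.neg-distrib-+ x y)) (shift-⊕ (- x) (- y) u w) }
  ; hom-⊙    = λ { c (x ∷ u) →
      trans (cong (λ t → shift t (c ⊙ u)) (ℤP.neg-distribʳ-* (+ c) x)) (shift-⊙ c (- x) u) }
  ; hom-zero = shift-identity zeroV
  }

shear-hom : ∀ {n} → IsHom (shear {n})
shear-hom = record
  { hom-⊕    = λ { (x ∷ u) (y ∷ w) → cong (x ℤ.+ y ∷_) (shift-⊕ x y u w) }
  ; hom-⊙    = λ { c (x ∷ u) → cong (+ c ℤ.* x ∷_) (shift-⊙ c x u) }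
  ; hom-zero = cong (0ℤ ∷_) (shift-identity zeroV)
  }

shift-cancel : ∀ {n} x y (u : Point n) → x ℤ.+ y ≡ 0ℤ → shift x (shift y u) ≡ u
shift-cancel x y u x+y≡0 = begin
  shift x (shift y u) ≡⟨ shift-shift x y u ⟩
  shift (x ℤ.+ y) u   ≡⟨ cong (λ t → shift t u) x+y≡0 ⟩
  shift 0ℤ u          ≡⟨ shift-identity u ⟩
  u                   ∎
  where open ≡-Reasoning

norm-shear : ∀ {n} z (u : Point n) → norm (shear (z ∷ u)) ≡ u
norm-shear z u = shift-cancel (- z) z u (ℤP.+-inverseˡ z)

shear-norm : ∀ {n} x (u : Point n) → shear (x ∷ norm (x ∷ u)) ≡ x ∷ u
shear-norm x u = cong (x ∷_) (shift-cancel x (- x) u (ℤP.+-inverseʳ x))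

norm-origin : ∀ {n} (u : Point n) → norm (0ℤ ∷ u) ≡ u
norm-origin = shift-identity

norm-shift : ∀ {n} z (v : Point (suc n)) → norm (shift z v) ≡ norm v
norm-shift z (x ∷ u) = begin
  shift (- (z ℤ.+ x)) (shift z u) ≡⟨ shift-shift (- (z ℤ.+ x)) z u ⟩
  shift (- (z ℤ.+ x) ℤ.+ z) u     ≡⟨ cong (λ t → shift t u) (solve 2 (λ z x → :- (z :+ x) :+ z := :- x) refl z x) ⟩
  shift (- x) u                   ∎
  where open ≡-Reasoning; open +-*-Solver

-- An equivariant set is determined by its slice: translate v so that its
-- first coordinate becomes 0.
equivariant-slice : ∀ {n} {X : Subset (suc n)} → Equivariant X →
  ∀ v → (X v → slice X (norm v)) × (slice X (norm v) → X v)
equivariant-slice {X = X} eqv (x ∷ u) =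
  (λ Xv → subst X to-origin (proj₁ (eqv (- x) (x ∷ u)) Xv)) ,
  (λ X0 → proj₂ (eqv (- x) (x ∷ u)) (subst X (sym to-origin) X0))
  where
  to-origin : shift (- x) (x ∷ u) ≡ 0ℤ ∷ norm (x ∷ u)
  to-origin = cong (_∷ shift (- x) u) (ℤP.+-inverseˡ x)

slice-injective : ∀ {n} {X Y : Subset (suc n)} → Equivariant X → Equivariant Y →
  slice X ≐ slice Y → X ≐ Y
slice-injective eqvX eqvY slices v =
  (λ Xv → proj₂ (equivariant-slice eqvY v) (proj₁ (slices (norm v)) (proj₁ (equivariant-slice eqvX v) Xv))) ,
  (λ Yv → proj₂ (equivariant-slice eqvX v) (proj₂ (slices (norm v)) (proj₁ (equivariant-slice eqvY v) Yv)))

image-norm-slice : ∀ {n} {X : Subset (suc n)} → Equivariant X → Image norm X ≐ slice X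
image-norm-slice eqv w =
  (λ { (v , Xv , refl) → proj₁ (equivariant-slice eqv v) Xv }) ,
  (λ Xw → 0ℤ ∷ w , Xw , norm-origin w)

Unslice : ∀ {n} → Subset n → Subset (suc n)
Unslice Y v = Y (norm v)

unslice-equivariant : ∀ {n} (Y : Subset n) → Equivariant (Unslice Y)
unslice-equivariant Y z v = subst Y (sym (norm-shift z v)) , subst Y (norm-shift z v)

slice-unslice : ∀ {n} (Y : Subset n) → slice (Unslice Y) ≐ Y
slice-unslice Y w = subst Y (norm-origin w) , subst Y (sym (norm-origin w))

image-shear-cyl : ∀ {n} (Y : Subset n) → Image shear (Cyl Y) ≐ Unslice Y
image-shear-cyl Y (x ∷ u) =
  (λ { ((z ∷ w) , Yw , refl) → subst Y (sym (norm-shear z w)) Yw }) ,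
  (λ Y-norm → (x ∷ norm (x ∷ u)) , Y-norm , shear-norm x u)

lemma4 : (n : ℕ) →
    ((X : Subset (suc n)) → Semilinear X → Equivariant X → Semilinear (slice X))
    × ((X Y : Subset (suc n)) → Semilinear X → Equivariant X →
        Semilinear Y → Equivariant Y → slice X ≐ slice Y → X ≐ Y)
    × ((Y : Subset n) → Semilinear Y →
        Σ (Subset (suc n)) λ X → Semilinear X × Equivariant X × (slice X ≐ Y))
lemma4 n = well-defined , injective , surjective
  where
  well-defined : (X : Subset (suc n)) → Semilinear X → Equivariant X → Semilinear (slice X)
  well-defined X semX eqvX = semilinear-resp (image-norm-slice eqvX) (semilinear-image norm-hom semX)

  injective : (X Y : Subset (suc n)) → Semilinear X → Equivariant X →
    Semilinear Y → Equivariant Y → slice X ≐ slice Y → X ≐ Y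
  injective X Y _ eqvX _ eqvY = slice-injective eqvX eqvY

  surjective : (Y : Subset n) → Semilinear Y →
    Σ (Subset (suc n)) λ X → Semilinear X × Equivariant X × (slice X ≐ Y)
  surjective Y semY =
    Unslice Y ,
    semilinear-resp (image-shear-cyl Y) (semilinear-image shear-hom (semilinear-cyl semY)) ,
    unslice-equivariant Y ,
    slice-unslice Y
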